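{- Let $\mathfrak{m}=(\pi,S)$ be a marked perfect matching with respect to $(n_1,\dots,n_k)$ having at least one homogeneous edge. Suppose the set $\{j: e_j \text{ homogeneous},\ \mathrm{bdiff}_{\mathfrak{m}}(e_j)<0\}$ is nonempty, let $i$ be its minimum, and suppose $e_i$ is not convertible in $\mathfrak{m}$. Then $e_i\in S$.
   Context: Fix positive integers $n_1,\dots,n_k$ and $N=n_1+\dots+n_k$. Let $\pi$ be a permutation of $[N]$, viewed as a perfect matching with edges $e_i=(i,\overline{\pi(i)})$. An edge $e_i$ is homogeneous if $n_1+\dots+n_{r-1}+1\le i,\pi(i)\le n_1+\dots+n_r$ for some $r\in[k]$, inhomogeneous otherwise. A marked perfect matching is a pair $\mathfrak{m}=(\pi,S)$ with $S$ a set of edges of $\pi$ containing all inhomogeneous edges (edges in $S$ are marked). $\mathrm{bind}^U_{\mathfrak{m}}(i)$ is $1$ plus the number of $u<i$ with $e_u\in S$; $\mathrm{bind}^L_{\mathfrak{m}}(j)$ is $1$ plus the number of $v<j$ such that the edge with lower endpoint $\bar v$ is in $S$; $\mathrm{bdiff}_{\mathfrak{m}}(e_i)=\mathrm{bind}^L_{\mathfrak{m}}(\pi(i))-\mathrm{bind}^U_{\mathfrak{m}}(i)$. Say $e_j$ crosses $e_i$ from the left (equivalently $e_i$ crosses $e_j$ from the right) if $j<i$ and $\pi(j)>\pi(i)$. A homogeneous edge $e$ is convertible in $\mathfrak{m}$ if: when $e\notin S$, every edge $e'$ crossing $e$ either crosses $e$ from the left with $\mathrm{bdiff}_{\mathfrak{m}}(e')\ge0$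 or crosses $e$ from the right with $\mathrm{bdiff}_{\mathfrak{m}}(e')\le-1$; when $e\in S$, every edge $e'$ crossing $e$ either crosses $e$ from the left with $\mathrm{bdiff}_{\mathfrak{m}}(e')>0$ or crosses $e$ from the right with $\mathrm{bdiff}_{\mathfrak{m}}(e')<-1$. -}

module Defs where

open import Data.Nat using (ℕ; zero; suc; _+_; _≤_; _<_; _<ᵇ_)
open import Data.List using (List; length; take; lookup)
open import Data.Nat.ListAction using (sum)
open import Data.Fin using (Fin; toℕ) renaming (zero to fzero; suc to fsuc)
open import Data.Fin.Permutation using (Permutation′; _⟨$⟩ʳ_; _⟨$⟩ˡ_)
open import Data.Fin.Subset using (Subset; _∈_; _∉_)
import Data.Vec as Vec
open import Data.Bool using (Bool; true; false; if_then_else_; _∧_)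
open import Data.Integer as ℤ using (ℤ; +_; _-_)
open import Data.Product using (Σ; _×_; ∃)
open import Data.Sum using (_⊎_)

-- Positions are 0-indexed: position p ∈ Fin N stands for p+1 ∈ [N].
-- The composition (n_1,…,n_k) is a list ns; N = sum ns.

count : ∀ {N} → (Fin N → Bool) → ℕ
count {zero} f = 0
count {suc N} f = (if f fzero then 1 else 0) + count (λ u → f (fsuc u))

offset : (ns : List ℕ) → Fin (length ns) → ℕ
offset ns r = sum (take (toℕ r) ns)

InBlock : (ns : List ℕ) → Fin (length ns) → ∀ {N} → Fin N → Set
InBlock ns r x = offset ns r ≤ toℕ x × toℕ x < offset ns r + lookup ns r

-- edge e_i = (i, π(i)-bar) is homogeneous
Homogeneous : (ns : List ℕ) → Permutation′ (sum ns) → Fin (sum ns) → Set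
Homogeneous ns π i = ∃ λ r → InBlock ns r i × InBlock ns r (π ⟨$⟩ʳ i)

-- marked perfect matching: S (edges e_u identified with their upper index u)
-- contains all inhomogeneous edges
IsMarked : (ns : List ℕ) → Permutation′ (sum ns) → Subset (sum ns) → Set
IsMarked ns π S = ∀ i → (Homogeneous ns π i → Data.Empty.⊥) → i ∈ S
  where import Data.Empty

bindU : ∀ {N} → Subset N → Fin N → ℕ
bindU S i = suc (count (λ u → (toℕ u <ᵇ toℕ i) ∧ Vec.lookup S u))

-- bind^L(j) = 1 + #{v < j : the edge with lower endpoint v-bar, i.e. e_{π⁻¹(v)}, is in S}
bindL : ∀ {N} → Permutation′ N → Subset N → Fin N → ℕ
bindL π S j = suc (count (λ v → (toℕ v <ᵇ toℕ j) ∧ Vec.lookup S (π ⟨$⟩ˡ v)))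

bdiff : ∀ {N} → Permutation′ N → Subset N → Fin N → ℤ
bdiff π S i = + bindL π S (π ⟨$⟩ʳ i) - + bindU S i

CrossesFromLeft : ∀ {N} → Permutation′ N → Fin N → Fin N → Set
CrossesFromLeft π j i = toℕ j < toℕ i × toℕ (π ⟨$⟩ʳ i) < toℕ (π ⟨$⟩ʳ j)

Crosses : ∀ {N} → Permutation′ N → Fin N → Fin N → Set
Crosses π j i = CrossesFromLeft π j i ⊎ CrossesFromLeft π i j

Convertible : ∀ {N} → Permutation′ N → Subset N → Fin N → Set
Convertible π S i =
  (i ∉ S → ∀ j → Crosses π j i →
     (CrossesFromLeft π j i × + 0 ℤ.≤ bdiff π S j)
     ⊎ (CrossesFromLeft π i j × bdiff π S j ℤ.≤ ℤ.- + 1))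
  × (i ∈ S → ∀ j → Crosses π j i →
     (CrossesFromLeft π j i × + 0 ℤ.< bdiff π S j)
     ⊎ (CrossesFromLeft π i j × bdiff π S j ℤ.< ℤ.- + 1))

-- Suppose e_i were unmarked; we show that it is then convertible. An edge e_j crossing e_i
-- from the right has i < j and π(j) < π(i), so both bind indices of e_j are at least those
-- of e_i and bdiff(e_j) ≤ bdiff(e_i) < 0. An edge e_j crossing e_i from the left either is
-- homogeneous in the block of e_i, and then bdiff(e_j) ≥ 0 by minimality of i, or it spans
-- a boundary b of that block: j ≤ b ≤ π(j). Every edge with exactly one endpoint below a
-- block boundary is inhomogeneous, hence marked, and as many edges cross b downwards as
-- upwards; so b has as many marked upper endpoints below it as marked lower endpoints,
-- and bind^U(j) ≤ bind^L(π(j)) follows by monotonicity.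
module Submission where

open import Defs
open import Data.Nat using (ℕ; _≤_; _<_)
open import Data.List using (List)
open import Data.Nat.ListAction using (sum)
open import Data.List.Relation.Unary.All using (All)
open import Data.Fin using (Fin; toℕ)
open import Data.Fin.Permutation using (Permutation′)
open import Data.Fin.Subset using (Subset; _∈_)
open import Data.Integer as ℤ using (+_)
open import Data.Product using (∃)
open import Relation.Nullary using (¬_)

import Algebra.Properties.CommutativeMonoid.Sum as CommutativeMonoidSum
open import Data.Bool using (Bool; true; false; T; not; _∧_; if_then_else_)
open import Data.Bool.Properties as Bool using (∧-zeroʳ; T-≡; T-∧)
open import Data.Empty using (⊥-elim)
open import Data.Fin using () renaming (zero to fzero; suc to fsuc)
open import Data.Fin.Permutation using (_⟨$⟩ʳ_; _⟨$⟩ˡ_; inverseˡ)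
open import Data.Fin.Subset.Properties using (_∈?_)
open import Data.Integer.Properties as ℤₚ using ()
open import Data.List using ([]; _∷_; _∷ʳ_; take; lookup; length)
open import Data.List.Properties using (take-suc)
open import Data.Nat using (zero; suc; _+_; _<ᵇ_; z≤n; s≤s; _≤?_; _<?_)
open import Data.Nat.ListAction.Properties using (sum-++)
open import Data.Nat.Properties as ℕₚ using (<ᵇ⇒<; <⇒<ᵇ)
open import Data.Product using (_,_; _×_)
open import Data.Sum using (_⊎_; inj₁; inj₂)
open import Data.Vec using () renaming (lookup to _!_)
open import Data.Vec.Properties using ([]=⇒lookup)
open import Function using (_∘_; Equivalence)
open import Relation.Binary.PropositionalEquality
open import Relation.Nullary using (Dec; yes; no; contradiction)
open import Relation.Nullary.Decidable using (decidable-stable)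

private
  variable
    N b b′ : ℕ

count-cong : {f g : Fin N → Bool} → f ≗ g → count f ≡ count g
count-cong {zero}  f≗g = refl
count-cong {suc N} f≗g =
  cong₂ _+_ (cong (λ x → if x then 1 else 0) (f≗g fzero)) (count-cong (f≗g ∘ fsuc))

count-mono : {f g : Fin N → Bool} → (∀ u → T (f u) → T (g u)) → count f ≤ count g
count-mono {zero}          f⇒g = z≤n
count-mono {suc N} {f} {g} f⇒g with f fzero | g fzero | f⇒g fzero
... | true  | true  | _  = s≤s (count-mono (f⇒g ∘ fsuc))
... | true  | false | ff = ⊥-elim (ff _)
... | false | true  | _  = ℕₚ.m≤n⇒m≤1+n (count-mono (f⇒g ∘ fsuc))
... | false | false | _  = count-mono (f⇒g ∘ fsuc)

count-split : (f g : Fin N → Bool) →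
              count f ≡ count (λ u → f u ∧ g u) + count (λ u → f u ∧ not (g u))
count-split {zero}  f g = refl
count-split {suc N} f g with f fzero | g fzero | count-split (f ∘ fsuc) (g ∘ fsuc)
... | false | _     | ih = ih
... | true  | true  | ih = cong suc ih
... | true  | false | ih = trans (cong suc ih) (sym (ℕₚ.+-suc _ _))

module ℕSum = CommutativeMonoidSum ℕₚ.+-0-commutativeMonoid

indicator : (Fin N → Bool) → Fin N → ℕ
indicator f u = if f u then 1 else 0

count≡sum : (f : Fin N → Bool) → count f ≡ ℕSum.sum (indicator f)
count≡sum {zero}  f = refl
count≡sum {suc N} f = cong (_+_ (indicator f fzero)) (count≡sum (f ∘ fsuc))

count-permute : (π : Permutation′ N) (f : Fin N → Bool) → count f ≡ count (λ u → f (π ⟨$⟩ʳ u))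
count-permute π f = begin
  count f                                ≡⟨ count≡sum f ⟩
  ℕSum.sum (indicator f)                 ≡⟨ ℕSum.sum-permute (indicator f) π ⟩
  ℕSum.sum (indicator (f ∘ (π ⟨$⟩ʳ_)))   ≡⟨ count≡sum (f ∘ (π ⟨$⟩ʳ_)) ⟨
  count (λ u → f (π ⟨$⟩ʳ u))             ∎
  where open ≡-Reasoning

-- Split count f = count (f ∘ π) along g: the parts outside g agree termwise, so the parts inside do.
count-∧-permute : (π : Permutation′ N) (f g : Fin N → Bool) →
                  (∀ u → g u ≡ false → f u ≡ f (π ⟨$⟩ʳ u)) →
                  count (λ u → f u ∧ g u) ≡ count (λ u → f (π ⟨$⟩ʳ u) ∧ g u)
count-∧-permute π f g invariant = ℕₚ.+-cancelʳ-≡ _ _ _ (begin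
  count (λ u → f u ∧ g u) + count (λ u → f u ∧ not (g u))
    ≡⟨ count-split f g ⟨
  count f
    ≡⟨ count-permute π f ⟩
  count (f ∘ σ)
    ≡⟨ count-split (f ∘ σ) g ⟩
  count (λ u → f (σ u) ∧ g u) + count (λ u → f (σ u) ∧ not (g u))
    ≡⟨ cong (_+_ _) (count-cong off-g) ⟨
  count (λ u → f (σ u) ∧ g u) + count (λ u → f u ∧ not (g u))
    ∎)
  where
  open ≡-Reasoning
  σ : Fin _ → Fin _
  σ = π ⟨$⟩ʳ_
  off-g : ∀ u → f u ∧ not (g u) ≡ f (σ u) ∧ not (g u)
  off-g u with g u in g≡
  ... | true  = trans (∧-zeroʳ (f u)) (sym (∧-zeroʳ (f (σ u))))
  ... | false = cong (_∧ true) (invariant u g≡)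

<ᵇ-true : ∀ {x y} → x < y → (x <ᵇ y) ≡ true
<ᵇ-true = Equivalence.to T-≡ ∘ <⇒<ᵇ

<ᵇ-false : ∀ {x y} → y ≤ x → (x <ᵇ y) ≡ false
<ᵇ-false {x} {y} y≤x with x <ᵇ y in x<ᵇy
... | false = refl
... | true  = contradiction (<ᵇ⇒< x y (subst T (sym x<ᵇy) _)) (ℕₚ.≤⇒≯ y≤x)

<ᵇ-∧-mono : b ≤ b′ → ∀ x c → T ((x <ᵇ b) ∧ c) → T ((x <ᵇ b′) ∧ c)
<ᵇ-∧-mono {b} b≤b′ x c x<b∧c with x<b , c-holds ← Equivalence.to T-∧ x<b∧c =
  Equivalence.from T-∧ (<⇒<ᵇ (ℕₚ.<-≤-trans (<ᵇ⇒< x b x<b) b≤b′) , c-holds)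

markedUpper : Subset N → ℕ → ℕ
markedUpper S b = count (λ u → (toℕ u <ᵇ b) ∧ (S ! u))

markedLower : Permutation′ N → Subset N → ℕ → ℕ
markedLower π S b = count (λ v → (toℕ v <ᵇ b) ∧ (S ! (π ⟨$⟩ˡ v)))

markedUpper-mono : (S : Subset N) → b ≤ b′ → markedUpper S b ≤ markedUpper S b′
markedUpper-mono S b≤b′ = count-mono (λ u → <ᵇ-∧-mono b≤b′ (toℕ u) (S ! u))

markedLower-mono : (π : Permutation′ N) (S : Subset N) →
                   b ≤ b′ → markedLower π S b ≤ markedLower π S b′
markedLower-mono π S b≤b′ = count-mono (λ v → <ᵇ-∧-mono b≤b′ (toℕ v) (S ! (π ⟨$⟩ˡ v)))

CleanCut : Permutation′ N → Subset N → ℕ → Set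
CleanCut π S b = ∀ u → (toℕ u <ᵇ b) ≢ (toℕ (π ⟨$⟩ʳ u) <ᵇ b) → u ∈ S

cleanCut⇒markedLower≡markedUpper : (π : Permutation′ N) (S : Subset N) →
                                   CleanCut π S b → markedLower π S b ≡ markedUpper S b
cleanCut⇒markedLower≡markedUpper {b = b} π S clean = begin
  markedLower π S b
    ≡⟨ count-permute π _ ⟩
  count (λ u → (toℕ (σ u) <ᵇ b) ∧ (S ! (π ⟨$⟩ˡ σ u)))
    ≡⟨ count-cong (λ u → cong (λ w → (toℕ (σ u) <ᵇ b) ∧ (S ! w)) (inverseˡ π)) ⟩
  count (λ u → (toℕ (σ u) <ᵇ b) ∧ (S ! u))
    ≡⟨ count-∧-permute π (λ u → toℕ u <ᵇ b) (S !_) unmarked-uncut ⟨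
  markedUpper S b
    ∎
  where
  open ≡-Reasoning
  σ : Fin _ → Fin _
  σ = π ⟨$⟩ʳ_
  unmarked-uncut : ∀ u → S ! u ≡ false → (toℕ u <ᵇ b) ≡ (toℕ (σ u) <ᵇ b)
  unmarked-uncut u unmarked with (toℕ u <ᵇ b) Bool.≟ (toℕ (σ u) <ᵇ b)
  ... | yes same = same
  ... | no  cut  = contradiction (trans (sym ([]=⇒lookup (clean u cut))) unmarked) λ ()

bdiff-nonneg-across-cleanCut : (π : Permutation′ N) (S : Subset N) → CleanCut π S b →
                               ∀ {j} → toℕ j ≤ b → b ≤ toℕ (π ⟨$⟩ʳ j) → + 0 ℤ.≤ bdiff π S j
bdiff-nonneg-across-cleanCut {b = b} π S clean {j} j≤b b≤σj =
  ℤₚ.i≤j⇒0≤j-i (ℤ.+≤+ (s≤s (begin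
    markedUpper S (toℕ j)            ≤⟨ markedUpper-mono S j≤b ⟩
    markedUpper S b                  ≡⟨ cleanCut⇒markedLower≡markedUpper {b = b} π S clean ⟨
    markedLower π S b                ≤⟨ markedLower-mono π S b≤σj ⟩
    markedLower π S (toℕ (π ⟨$⟩ʳ j)) ∎)))
  where open ℕₚ.≤-Reasoning

crossesFromLeft⇒bdiff-≤ : (π : Permutation′ N) (S : Subset N) →
                          ∀ {i j} → CrossesFromLeft π i j → bdiff π S j ℤ.≤ bdiff π S i
crossesFromLeft⇒bdiff-≤ π S (i<j , σj<σi) = ℤₚ.+-mono-≤
  (ℤ.+≤+ (s≤s (markedLower-mono π S (ℕₚ.<⇒≤ σj<σi))))
  (ℤₚ.neg-mono-≤ (ℤ.+≤+ (s≤s (markedUpper-mono S (ℕₚ.<⇒≤ i<j)))))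

take-sum-mono : ∀ ns {m m′} → m ≤ m′ → sum (take m ns) ≤ sum (take m′ ns)
take-sum-mono []       {zero}          _         = z≤n
take-sum-mono []       {suc m}         _         = z≤n
take-sum-mono (n ∷ ns) {zero}          _         = z≤n
take-sum-mono (n ∷ ns) {suc m} {suc m′} (s≤s m≤m′) = ℕₚ.+-monoʳ-≤ n (take-sum-mono ns m≤m′)

offset-suc : ∀ ns (r : Fin (length ns)) → sum (take (suc (toℕ r)) ns) ≡ offset ns r + lookup ns r
offset-suc ns r = begin
  sum (take (suc (toℕ r)) ns)           ≡⟨ cong sum (take-suc ns r) ⟩
  sum (take (toℕ r) ns ∷ʳ lookup ns r)  ≡⟨ sum-++ (take (toℕ r) ns) _ ⟩
  offset ns r + (lookup ns r + 0)       ≡⟨ cong (_+_ (offset ns r)) (ℕₚ.+-identityʳ _) ⟩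
  offset ns r + lookup ns r             ∎
  where open ≡-Reasoning

take-sum-outside-block : ∀ ns m (r : Fin (length ns)) →
                         sum (take m ns) ≤ offset ns r ⊎ offset ns r + lookup ns r ≤ sum (take m ns)
take-sum-outside-block ns m r with m ≤? toℕ r
... | yes m≤r = inj₁ (take-sum-mono ns m≤r)
... | no  m≰r =
  inj₂ (subst (_≤ sum (take m ns)) (offset-suc ns r) (take-sum-mono ns (ℕₚ.≰⇒> m≰r)))

inBlock-<ᵇ-take-sum : ∀ ns {r} {x : Fin N} → InBlock ns r x → ∀ m →
                      (toℕ x <ᵇ sum (take m ns)) ≡ (offset ns r <ᵇ sum (take m ns))
inBlock-<ᵇ-take-sum ns {r} (o≤x , x<e) m with take-sum-outside-block ns m r
... | inj₁ b≤o = trans (<ᵇ-false (ℕₚ.≤-trans b≤o o≤x)) (sym (<ᵇ-false b≤o))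
... | inj₂ e≤b = trans (<ᵇ-true x<b) (sym (<ᵇ-true (ℕₚ.≤-<-trans o≤x x<b)))
  where x<b = ℕₚ.<-≤-trans x<e e≤b

isMarked⇒cleanCut-take-sum : ∀ ns π S → IsMarked ns π S → ∀ m → CleanCut π S (sum (take m ns))
isMarked⇒cleanCut-take-sum ns π S marked m u cut = marked u λ (r , u∈r , πu∈r) →
  cut (trans (inBlock-<ᵇ-take-sum ns u∈r m) (sym (inBlock-<ᵇ-take-sum ns πu∈r m)))

crossesFromLeft-minimal⇒bdiff-nonneg :
  ∀ ns π S → IsMarked ns π S → ∀ {i} → Homogeneous ns π i →
  (∀ j → Homogeneous ns π j → bdiff π S j ℤ.< + 0 → toℕ i ≤ toℕ j) →
  ∀ {j} → CrossesFromLeft π j i → + 0 ℤ.≤ bdiff π S j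
crossesFromLeft-minimal⇒bdiff-nonneg ns π S marked (r , (_ , i<e) , (o≤σi , _)) minimal
                                     {j} (j<i , σi<σj) =
  by-position (toℕ j <? offset ns r) (toℕ (π ⟨$⟩ʳ j) <? offset ns r + lookup ns r)
  where
  o≤σj : offset ns r ≤ toℕ (π ⟨$⟩ʳ j)
  o≤σj = ℕₚ.≤-trans o≤σi (ℕₚ.<⇒≤ σi<σj)
  j<e : toℕ j < offset ns r + lookup ns r
  j<e = ℕₚ.<-trans j<i i<e
  block-start-clean : CleanCut π S (offset ns r)
  block-start-clean = isMarked⇒cleanCut-take-sum ns π S marked (toℕ r)
  block-end-clean : CleanCut π S (offset ns r + lookup ns r)
  block-end-clean =
    subst (CleanCut π S) (offset-suc ns r) (isMarked⇒cleanCut-take-sum ns π S marked (suc (toℕ r)))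
  by-position : Dec (toℕ j < offset ns r) → Dec (toℕ (π ⟨$⟩ʳ j) < offset ns r + lookup ns r) →
                + 0 ℤ.≤ bdiff π S j
  by-position (yes j<o) _ =
    bdiff-nonneg-across-cleanCut π S block-start-clean (ℕₚ.<⇒≤ j<o) o≤σj
  by-position (no j≮o) (yes σj<e) =
    ℤₚ.≮⇒≥ λ negative → ℕₚ.<⇒≱ j<i (minimal j homogeneous negative)
    where
    homogeneous : Homogeneous ns π j
    homogeneous = r , (ℕₚ.≮⇒≥ j≮o , j<e) , (o≤σj , σj<e)
  by-position (no _) (no σj≮e) =
    bdiff-nonneg-across-cleanCut π S block-end-clean (ℕₚ.<⇒≤ j<e) (ℕₚ.≮⇒≥ σj≮e)

lemma4p2 : (ns : List ℕ) → All (λ n → 1 ≤ n) ns →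
    (π : Permutation′ (sum ns)) (S : Subset (sum ns)) → IsMarked ns π S →
    (∃ λ j → Homogeneous ns π j) →
    (i : Fin (sum ns)) → Homogeneous ns π i → bdiff π S i ℤ.< + 0 →
    (∀ j → Homogeneous ns π j → bdiff π S j ℤ.< + 0 → toℕ i ≤ toℕ j) →
    ¬ Convertible π S i →
    i ∈ S
lemma4p2 ns _ π S marked _ i homogeneous negative minimal ¬convertible =
  decidable-stable (i ∈? S) λ i∉S →
    ¬convertible ((λ _ → crossing-condition) , (λ i∈S → contradiction i∈S i∉S))
  where
  crossing-condition : ∀ j → Crosses π j i →
    (CrossesFromLeft π j i × + 0 ℤ.≤ bdiff π S j) ⊎ (CrossesFromLeft π i j × bdiff π S j ℤ.≤ ℤ.- + 1)
  crossing-condition j (inj₁ j↘i) =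
    inj₁ (j↘i , crossesFromLeft-minimal⇒bdiff-nonneg ns π S marked homogeneous minimal j↘i)
  crossing-condition j (inj₂ i↘j) =
    inj₂ (i↘j , ℤₚ.i<j⇒i≤pred[j] (ℤₚ.≤-<-trans (crossesFromLeft⇒bdiff-≤ π S i↘j) negative))
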